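{- Let $(W,S)$ be a finite Coxeter system, $I\subseteq S$, $L\ge 0$ an integer, and $U_L=\{wW_I:\ell(w^I)\le L\}$. If $J\subseteq W/W_I$ satisfies $U_L\subseteq J$, then there exist a sequence $J=J_0,J_1,\dots,J_n$ of subsets of $W/W_I$ and simple reflections $s_0,\dots,s_{n-1}\in S$ such that $J_{i+1}=J_i^+(s_i)$ for each $i=0,\dots,n-1$ and $U_{L+1}\subseteq J_n$.
   Context: A finite Coxeter system $(W,S)$: $W$ is a finite group with generating set $S=\{s_1,\dots,s_m\}$ and presentation $\langle s_1,\dots,s_m \mid (s_is_j)^{m_{ij}}=1\rangle$, $m_{ii}=1$, $m_{ij}=m_{ji}\ge2$ for $i\ne j$. $\ell(w)$ is the length of $w$ with respect to $S$. For $I\subseteq S$, $W_I=\langle I\rangle$ and $w^I$ is the unique minimum-length element of $wW_I$. For $s\in S$ (more generally any reflection $t=usu^{ -1}$), let $R^I_t=\{wW_I:\ell((tw)^I)<\ell(w^I)\}$; the left-folding map $t^+$ on $W/W_I$ sends $wW_I$ to $twW_I$ if $wW_I\in R^I_t$ and fixes it otherwise; for $J\subseteq W/W_I$, $J^+(t)=\{wW_I:t^+(wW_I)\in J\}$. -}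

module Defs where

open import Data.Nat using (ℕ; zero; suc; _≤_)
open import Data.Fin using (Fin)
open import Data.Fin.Subset using (Subset; _∈_)
open import Data.List using (List; []; _∷_; _++_; length)
open import Data.List.Relation.Unary.All using (All)
import Data.List.Membership.Propositional as LM
open import Data.Product using (Σ; ∃; _×_; _,_)
open import Data.Sum using (_⊎_)
open import Relation.Nullary using (¬_; Dec)
open import Relation.Binary.PropositionalEquality using (_≡_; _≢_)

Word : ℕ → Set
Word m = List (Fin m)

braid : ∀ {m} → Fin m → Fin m → ℕ → Word m
braid i j zero    = []
braid i j (suc k) = i ∷ j ∷ braid i j k

-- The congruence on words generated by the Coxeter relations (s_i s_j)^{M i j} = 1.
-- Since every generator is an involution (M i i = 1), the group presented by
-- ⟨S ∣ (s_i s_j)^{m_ij}⟩ equals the monoid presented by the same relations.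
data _≈[_]_ {m : ℕ} : Word m → (Fin m → Fin m → ℕ) → Word m → Set where
  rel   : ∀ {M} u v i j → (u ++ braid i j (M i j) ++ v) ≈[ M ] (u ++ v)
  refl  : ∀ {M} u → u ≈[ M ] u
  sym   : ∀ {M u v} → u ≈[ M ] v → v ≈[ M ] u
  trans : ∀ {M u v w} → u ≈[ M ] v → v ≈[ M ] w → u ≈[ M ] w

evalWord : ∀ {m} {W : Set} → (W → W → W) → W → (Fin m → W) → Word m → W
evalWord _·_ e g []      = e
evalWord _·_ e g (i ∷ w) = g i · evalWord _·_ e g w

-- A finite Coxeter system (W,S) of rank m: W is a finite group (decidable equality,
-- explicit enumeration) with generators gen : Fin m → W, and W is presented by
-- ⟨gen ∣ (gen i gen j)^{M i j} = 1⟩ (generation + relations hold + every relation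
-- of W is a consequence of the Coxeter relations).
record CoxeterSystem (m : ℕ) : Set₁ where
  field
    M      : Fin m → Fin m → ℕ
    M-diag : ∀ i → M i i ≡ 1
    M-sym  : ∀ i j → M i j ≡ M j i
    M-off  : ∀ i j → i ≢ j → 2 ≤ M i j
    W      : Set
    _·_    : W → W → W
    e      : W
    _⁻¹    : W → W
    assoc  : ∀ x y z → (x · y) · z ≡ x · (y · z)
    idˡ    : ∀ x → e · x ≡ x
    idʳ    : ∀ x → x · e ≡ x
    invˡ   : ∀ x → (x ⁻¹) · x ≡ e
    invʳ   : ∀ x → x · (x ⁻¹) ≡ e
    _≟_    : (x y : W) → Dec (x ≡ y)
    elems  : List W
    finite : ∀ x → x LM.∈ elems
    gen    : Fin m → W

    generates    : ∀ x → ∃ λ (u : Word m) → evalWord _·_ e gen u ≡ x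
    relations    : ∀ i j → evalWord _·_ e gen (braid i j (M i j)) ≡ e
    presentation : ∀ (u : Word m) → evalWord _·_ e gen u ≡ e → u ≈[ M ] []

  ev : Word m → W
  ev = evalWord _·_ e gen

module _ {m : ℕ} (C : CoxeterSystem m) (I : Subset m) where
  open CoxeterSystem C

  InWI : W → Set
  InWI u = ∃ λ (v : Word m) → All (_∈ I) v × ev v ≡ u

  -- ℓ(w^I) ≤ n : the minimum length of an element of the coset w W_I is ≤ n
  -- (ℓ(w^I) is exactly this minimum, w^I being the minimal-length coset element).
  CosetLen≤ : W → ℕ → Set
  CosetLen≤ w n = ∃ λ (x : Word m) → length x ≤ n × ∃ λ u → InWI u × ev x ≡ w · u

  CosetLen< : W → W → Set
  CosetLen< x w = ∃ λ n → CosetLen≤ x n × ¬ CosetLen≤ w n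

  InR : Fin m → W → Set
  InR s w = CosetLen< (gen s · w) w

  U : ℕ → W → Set
  U L w = CosetLen≤ w L

  -- a subset of W/W_I, as a predicate on W invariant under right multiplication by W_I
  IsCosetSet : (W → Set) → Set
  IsCosetSet J = ∀ w u → InWI u → J w → J (w · u)

  _⁺_ : (W → Set) → Fin m → W → Set
  (J ⁺ s) w = (InR s w × J (gen s · w)) ⊎ (¬ InR s w × J w)

  iterate : (W → Set) → List (Fin m) → W → Set
  iterate J []       = J
  iterate J (s ∷ ss) = iterate (J ⁺ s) ss

{-# OPTIONS --safe #-}
-- Fold successively by all simple reflections s_0, …, s_{m-1}.  Folding by s never
-- loses U_L: a coset of U_L is either left alone or, if it lies in R_s, replaced by
-- s w W_I, whose coset length is smaller.  Folding by s also puts into J every coset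
-- of U_{L+1} lying in R_s, and a coset of U_{L+1} \ U_L contains a word s x with
-- ℓ(x) ≤ L, so it lies in R_s.  Neither step uses that J is W_I-invariant.
-- Constructively, the case split on w W_I ∈ R_s needs coset lengths to be decidable;
-- this holds because, by pigeonhole on suffixes, every element of W_I is a word in I
-- of length at most #elems.
module Submission where

open import Defs hiding (refl; sym; trans)
open import Data.Nat using (ℕ; zero; suc; s≤s; _≤_; _<_; _+_; _∸_; _⊓_; _<?_; z≤n)
open import Data.Nat.Properties
  using (≤-refl; ≤-trans; <⇒≤; ≮⇒≥; n≤1+n; ≤-pred; +-monoˡ-≤; +-monoˡ-<; m⊓n≤m; m+[n∸m]≡n; anyUpTo?; module ≤-Reasoning)
open import Data.Nat.Induction using (<-wellFounded)
open import Data.Fin using (Fin; toℕ)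
open import Data.Fin.Subset using (Subset)
open import Data.Fin.Subset.Properties using (_∈?_)
import Data.Fin.Properties as Fin
open import Data.List using (List; []; _∷_; _++_; length; take; drop; lookup; allFin)
open import Data.List.Properties using (length-++; length-take; length-drop; take++drop≡id)
open import Data.List.Relation.Unary.All using (All; all?)
open import Data.List.Relation.Unary.All.Properties using (++⁺; take⁺; drop⁺)
open import Data.List.Relation.Unary.Any as Any using (Any; here; there)
open import Data.List.Relation.Unary.Any.Properties using (lookup-index)
open import Data.List.Membership.Propositional using (lose)
open import Data.List.Membership.Propositional.Properties using (∈-allFin)
open import Data.Product using (∃; ∃₂; _×_; _,_)
open import Data.Sum using (_⊎_; inj₁; inj₂)
import Data.Sum as Sum
open import Induction.WellFounded using (Acc; acc)
open import Level using (0ℓ)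
open import Relation.Nullary using (Dec; yes; no; ¬_; contradiction)
open import Relation.Nullary.Decidable using (map′; _×-dec_; _⊎-dec_; ¬?)
open import Relation.Unary using (Pred; Decidable; _⊆_)
open import Relation.Binary.PropositionalEquality
  using (_≡_; refl; sym; trans; cong; cong₂; subst; module ≡-Reasoning)

anyWordUpTo? : ∀ {m} {P : Pred (Word m) 0ℓ} → Decidable P →
               ∀ n → Dec (∃ λ v → length v ≤ n × P v)
anyWordUpTo? P? zero =
  map′ (λ P[] → [] , z≤n , P[]) (λ { ([] , _ , P[]) → P[] }) (P? [])
anyWordUpTo? P? (suc n) =
  map′ (λ { (inj₁ P[]) → [] , z≤n , P[] ; (inj₂ (i , v , v≤n , P)) → i ∷ v , s≤s v≤n , P })
       (λ { ([] , _ , P[]) → inj₁ P[] ; (i ∷ v , s≤s v≤n , P) → inj₂ (i , v , v≤n , P) })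
       (P? [] ⊎-dec Fin.any? λ i → anyWordUpTo? (λ v → P? (i ∷ v)) n)

module _ {m : ℕ} (C : CoxeterSystem m) where
  open CoxeterSystem C

  ev-++ : ∀ u v → ev (u ++ v) ≡ ev u · ev v
  ev-++ []      v = sym (idˡ (ev v))
  ev-++ (i ∷ u) v = trans (cong (gen i ·_) (ev-++ u v)) (sym (assoc _ _ _))

  ⁻¹-cancelˡ : ∀ w x → (w ⁻¹) · (w · x) ≡ x
  ⁻¹-cancelˡ w x = trans (sym (assoc _ _ _)) (trans (cong (_· x) (invˡ w)) (idˡ x))

  ⁻¹-cancelʳ : ∀ w x → w · ((w ⁻¹) · x) ≡ x
  ⁻¹-cancelʳ w x = trans (sym (assoc _ _ _)) (trans (cong (_· x) (invʳ w)) (idˡ x))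

  gen-involutive : ∀ s x → gen s · (gen s · x) ≡ x
  gen-involutive s x = begin
    gen s · (gen s · x)  ≡⟨ sym (assoc _ _ _) ⟩
    (gen s · gen s) · x  ≡⟨ cong (λ g → (gen s · g) · x) (sym (idʳ (gen s))) ⟩
    ev (s ∷ s ∷ []) · x  ≡⟨ cong (_· x) (subst (λ k → ev (braid s s k) ≡ e) (M-diag s) (relations s s)) ⟩
    e · x                ≡⟨ idˡ x ⟩
    x                    ∎
    where open ≡-Reasoning

  #elems : ℕ
  #elems = length elems

  position : W → Fin #elems
  position x = Any.index (finite x)

  position-injective : ∀ {x y} → position x ≡ position y → x ≡ y
  position-injective {x} {y} eq =
    trans (lookup-index (finite x)) (trans (cong (lookup elems) eq) (sym (lookup-index (finite y))))

  excise : ℕ → ℕ → Word m → Word m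
  excise i j v = take i v ++ drop j v

  excise-length : ∀ {i j} v → i < j → j ≤ length v → length (excise i j v) < length v
  excise-length {i} {j} v i<j j≤∣v∣ = begin-strict
    length (take i v ++ drop j v)          ≡⟨ length-++ (take i v) ⟩
    length (take i v) + length (drop j v)  ≡⟨ cong₂ _+_ (length-take i v) (length-drop j v) ⟩
    i ⊓ length v + (length v ∸ j)          ≤⟨ +-monoˡ-≤ _ (m⊓n≤m i (length v)) ⟩
    i + (length v ∸ j)                     <⟨ +-monoˡ-< _ i<j ⟩
    j + (length v ∸ j)                     ≡⟨ m+[n∸m]≡n j≤∣v∣ ⟩
    length v                               ∎
    where open ≤-Reasoning

  excise-ev : ∀ {i j} v → ev (drop i v) ≡ ev (drop j v) → ev (excise i j v) ≡ ev v
  excise-ev {i} {j} v eq = begin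
    ev (take i v ++ drop j v)    ≡⟨ ev-++ (take i v) (drop j v) ⟩
    ev (take i v) · ev (drop j v) ≡⟨ cong (ev (take i v) ·_) (sym eq) ⟩
    ev (take i v) · ev (drop i v) ≡⟨ sym (ev-++ (take i v) (drop i v)) ⟩
    ev (take i v ++ drop i v)    ≡⟨ cong ev (take++drop≡id i v) ⟩
    ev v                         ∎
    where open ≡-Reasoning

  suffix-collision : ∀ v → #elems < length v →
                     ∃₂ λ i j → i < j × j ≤ length v × ev (drop i v) ≡ ev (drop j v)
  suffix-collision v long
    with i , j , i<j , same ← Fin.pigeonhole ≤-refl (λ k → position (ev (drop (toℕ k) v)))
    = toℕ i , toℕ j , i<j , ≤-trans (≤-pred (Fin.toℕ<n j)) (<⇒≤ long) , position-injective same

  shorten : ∀ {Q : Pred (Fin m) 0ℓ} {v} → All Q v →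
            ∃ λ v′ → All Q v′ × length v′ ≤ #elems × ev v′ ≡ ev v
  shorten {Q} q = go q (<-wellFounded _)
    where
    go : ∀ {v} → All Q v → Acc _<_ (length v) →
         ∃ λ v′ → All Q v′ × length v′ ≤ #elems × ev v′ ≡ ev v
    go {v} q (acc rec) with #elems <? length v
    ... | no short = v , q , ≮⇒≥ short , refl
    ... | yes long
      with i , j , i<j , j≤∣v∣ , same ← suffix-collision v long
      with v′ , q′ , v′≤ , v′≡ ← go (++⁺ (take⁺ i q) (drop⁺ j q)) (rec (excise-length v i<j j≤∣v∣))
      = v′ , q′ , v′≤ , trans v′≡ (excise-ev {i} {j} v same)

  module _ (I : Subset m) where

    InWI? : Decidable (InWI C I)
    InWI? u = map′ (λ { (v , _ , inI , v≡u) → v , inI , v≡u })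
                   (λ { (v , inI , v≡u) → let v′ , inI′ , v′≤ , v′≡v = shorten inI
                                           in  v′ , v′≤ , inI′ , trans v′≡v v≡u })
                   (anyWordUpTo? (λ v → all? (_∈? I) v ×-dec (ev v ≟ u)) #elems)

    CosetLen≤? : ∀ w n → Dec (CosetLen≤ C I w n)
    CosetLen≤? w = anyWordUpTo? λ x →
      map′ (λ inWI → (w ⁻¹) · ev x , inWI , sym (⁻¹-cancelʳ w (ev x)))
           (λ { (u , inWI , x≡wu) →
                  subst (InWI C I) (trans (sym (⁻¹-cancelˡ w u)) (cong ((w ⁻¹) ·_) (sym x≡wu))) inWI })
           (InWI? ((w ⁻¹) · ev x))

    CosetLen≤-mono : ∀ {w n n′} → n ≤ n′ → CosetLen≤ C I w n → CosetLen≤ C I w n′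
    CosetLen≤-mono n≤n′ (x , x≤n , coset) = x , ≤-trans x≤n n≤n′ , coset

    CosetLen≤∧¬CosetLen≤⇒< : ∀ {w k n} → CosetLen≤ C I w k → ¬ CosetLen≤ C I w n → n < k
    CosetLen≤∧¬CosetLen≤⇒< {k = k} {n} w≤k w≰n with n <? k
    ... | yes n<k = n<k
    ... | no  n≮k = contradiction (CosetLen≤-mono (≮⇒≥ n≮k) w≤k) w≰n

    CosetLen≤-suc⁻ : ∀ {w n} → CosetLen≤ C I w (suc n) →
                     CosetLen≤ C I w n ⊎ ∃ λ s → CosetLen≤ C I (gen s · w) n
    CosetLen≤-suc⁻ ([] , _ , coset) = inj₁ ([] , z≤n , coset)
    CosetLen≤-suc⁻ {w} (s ∷ x , s≤s x≤n , u , inWI , sx≡wu) = inj₂ (s , x , x≤n , u , inWI , x≡swu)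
      where
      open ≡-Reasoning
      x≡swu : ev x ≡ (gen s · w) · u
      x≡swu = begin
        ev x                 ≡⟨ sym (gen-involutive s (ev x)) ⟩
        gen s · ev (s ∷ x)   ≡⟨ cong (gen s ·_) sx≡wu ⟩
        gen s · (w · u)      ≡⟨ sym (assoc _ _ _) ⟩
        (gen s · w) · u      ∎

    InR⇒U : ∀ {L s w} → U C I (suc L) w → InR C I s w → U C I L (gen s · w)
    InR⇒U w∈U (n , sw≤n , w≰n) = CosetLen≤-mono (≤-pred (CosetLen≤∧¬CosetLen≤⇒< w∈U w≰n)) sw≤n

    InR? : ∀ {L} s {w} → U C I (suc L) w → Dec (InR C I s w)
    InR? {L} s {w} w∈U =
      map′ (λ { (n , _ , sw≤n , w≰n) → n , sw≤n , w≰n })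
           (λ { (n , sw≤n , w≰n) → n , CosetLen≤∧¬CosetLen≤⇒< w∈U w≰n , sw≤n , w≰n })
           (anyUpTo? (λ n → CosetLen≤? (gen s · w) n ×-dec ¬? (CosetLen≤? w n)) (suc L))

    U-suc⇒U⊎InR : ∀ {L w} → U C I (suc L) w → U C I L w ⊎ ∃ λ s → InR C I s w
    U-suc⇒U⊎InR {L} {w} w∈U with CosetLen≤? w L | CosetLen≤-suc⁻ w∈U
    ... | yes w∈U′ | _               = inj₁ w∈U′
    ... | no  _    | inj₁ w∈U′       = inj₁ w∈U′
    ... | no  w∉U′ | inj₂ (s , sw≤L) = inj₂ (s , L , sw≤L , w∉U′)

    ⁺-step : ∀ {L J s w} → U C I L ⊆ J → U C I (suc L) w → J w ⊎ InR C I s w → _⁺_ C I J s w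
    ⁺-step {s = s} U⊆J w∈U Jw⊎r with InR? s w∈U | Jw⊎r
    ... | yes r | _       = inj₁ (r , U⊆J (InR⇒U w∈U r))
    ... | no ¬r | inj₁ Jw = inj₂ (¬r , Jw)
    ... | no ¬r | inj₂ r  = contradiction r ¬r

    U⊆⁺ : ∀ {L J s} → U C I L ⊆ J → U C I L ⊆ _⁺_ C I J s
    U⊆⁺ U⊆J w∈U = ⁺-step U⊆J (CosetLen≤-mono (n≤1+n _) w∈U) (inj₁ (U⊆J w∈U))

    iterate-covers : ∀ {L J w} ss → U C I L ⊆ J → U C I (suc L) w →
                     J w ⊎ Any (λ s → InR C I s w) ss → iterate C I J ss w
    iterate-covers [] _ _ (inj₁ Jw) = Jw
    iterate-covers {J = J} {w} (s ∷ ss) U⊆J w∈U Jw⊎r =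
      iterate-covers ss (U⊆⁺ U⊆J) w∈U (fold Jw⊎r)
      where
      fold : J w ⊎ Any (λ t → InR C I t w) (s ∷ ss) → _⁺_ C I J s w ⊎ Any (λ t → InR C I t w) ss
      fold (inj₁ Jw)         = inj₁ (⁺-step U⊆J w∈U (inj₁ Jw))
      fold (inj₂ (here r))   = inj₁ (⁺-step U⊆J w∈U (inj₂ r))
      fold (inj₂ (there rs)) = inj₂ rs

proposition3p6 : ∀ {m : ℕ} (C : CoxeterSystem m) (I : Subset m) (L : ℕ)
    (J : CoxeterSystem.W C → Set) → IsCosetSet C I J
    → (∀ w → U C I L w → J w)
    → ∃ λ (ss : List (Fin m)) → ∀ w → U C I (suc L) w → iterate C I J ss w
proposition3p6 {m} C I L J _ U⊆J =
  allFin m , λ w w∈U → iterate-covers C I (allFin m) (λ {w} → U⊆J w) w∈U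
                         (Sum.map (U⊆J w) (λ (s , r) → lose (∈-allFin s) r) (U-suc⇒U⊎InR C I w∈U))
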